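{- Let $L$ be a three-dimensional lattice, $f : L \to L$, and $s = (*,*,s_3)$ a principal slice. If $(d, b)$ is a down set witness, then one of the following exists: (1) a point $c$ with $d \preceq c \preceq b$ and $c \in \mathrm{Up}(f)$; (2) two points $x, y$ with $d \preceq x \preceq y \preceq b$ that witness a violation of order preservation of $f$; (3) a point $c$ with $d \preceq c \preceq b$ and $c \in \mathrm{Down}(f_s)$.
   Context: $L = L(n_1,n_2,n_3)$ is the set of $x \in \mathbb{N}^3$ with $1 \le x_i \le n_i$, ordered by $x \preceq y$ iff $x_i \le y_i$ for all $i$. $\mathrm{Up}(f)=\{x : x \preceq f(x)\}$, $\mathrm{Down}(f)=\{x : f(x)\preceq x\}$. $L_s = \{x \in L : x_3 = s_3\}$, and the restriction $f_s : L_s \to L_s$ is given by $f_s(x)_i = f(x)_i$ for $i \in\{1,2\}$ and $f_s(x)_3 = s_3$; $\mathrm{Down}(f_s) = \{x \in L_s : f_s(x) \preceq x\}$. Points $x, y$ witness a violation of order preservation of $f$ if $x \preceq y$ and $f(x) \not\preceq f(y)$. A down set witness is a pair of points $(d,b)$ with $d, b \in L_s$ such that $d_3 \le f(d)_3$ and $b_3 \le f(b)_3$, and there exist $i, j \in \{1,2\}$ with $i \ne j$ such that $d_i = b_i$, $d_j \le b_j$, $d_j \le f(d)_j$ and $f(b)_j \le b_j$. -}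

module Defs where

open import Data.Nat using (ℕ; _≤_)
open import Data.Fin using (Fin; zero; suc)
open import Data.Product using (_×_; Σ; ∃; ∃-syntax; _,_)
open import Relation.Nullary using (¬_)
open import Relation.Binary.PropositionalEquality using (_≡_)

-- A point of ℕ³ as a function from the three coordinate indices
-- (index 0 = coordinate 1, index 1 = coordinate 2, index 2 = coordinate 3).
Point : Set
Point = Fin 3 → ℕ

i₁ i₂ i₃ : Fin 3
i₁ = zero
i₂ = suc zero
i₃ = suc (suc zero)

InL : (n : Point) → Point → Set
InL n x = (k : Fin 3) → (1 ≤ x k) × (x k ≤ n k)

_⪯_ : Point → Point → Set
x ⪯ y = (k : Fin 3) → x k ≤ y k

InUp : (n : Point) → (Point → Point) → Point → Set
InUp n f x = InL n x × (x ⪯ f x)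

InSlice : (n : Point) → (s₃ : ℕ) → Point → Set
InSlice n s₃ x = InL n x × (x i₃ ≡ s₃)

restrict : (Point → Point) → ℕ → Point → Point
restrict f s₃ x zero = f x zero
restrict f s₃ x (suc zero) = f x (suc zero)
restrict f s₃ x (suc (suc zero)) = s₃

InDownSlice : (n : Point) → (Point → Point) → ℕ → Point → Set
InDownSlice n f s₃ x = InSlice n s₃ x × (restrict f s₃ x ⪯ x)

Violation : (Point → Point) → Point → Point → Set
Violation f x y = (x ⪯ y) × ¬ (f x ⪯ f y)

data PlaneIdx : Set where
  one two : PlaneIdx

toFin : PlaneIdx → Fin 3
toFin one = i₁
toFin two = i₂

-- down set witness (d, b) in slice s₃: i ≠ j ∈ {1,2} means (i,j) = (1,2) or (2,1)
other : PlaneIdx → PlaneIdx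
other one = two
other two = one

DownSetWitness : (n : Point) → (Point → Point) → ℕ → Point → Point → Set
DownSetWitness n f s₃ d b =
  InSlice n s₃ d × InSlice n s₃ b ×
  (d i₃ ≤ f d i₃) × (b i₃ ≤ f b i₃) ×
  Σ PlaneIdx (λ i → let j = other i in
     (d (toFin i) ≡ b (toFin i)) × (d (toFin j) ≤ b (toFin j)) ×
     (d (toFin j) ≤ f d (toFin j)) × (f b (toFin j) ≤ b (toFin j)))

-- Walk from d towards b along the line through d in direction j (the i- and
-- third coordinates stay fixed), keeping the invariant x_j ≤ f(x)_j and
-- x₃ ≤ f(x)₃, which holds at d. At each point x of the walk either
-- x_i ≤ f(x)_i, so x ∈ Up(f); or f(x)_i ≤ x_i and f(x)_j ≤ x_j, so
-- x ∈ Down(f_s); or f(x)_j > x_j. In the last case, if f is order preserving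
-- between x and the next point y, the invariant passes to y. It cannot reach b,
-- since f(b)_j ≤ b_j, so one of the first two cases, or a violation of order
-- preservation between consecutive points, occurs on the way.
module Submission where

open import Defs
open import Data.Nat using (ℕ; zero; suc; _≤_; _<_; _≤′_; ≤′-refl; ≤′-step; _≤?_)
open import Data.Nat.Properties
  using (≤-refl; ≤-trans; ≤-reflexive; ≤-antisym; <⇒≤; <⇒≱; ≰⇒>; n≤1+n; m≤n⇒m≤1+n; ≤⇒≤′; ≤′⇒≤)
open import Data.Fin using (Fin; zero; suc)
open import Data.Fin.Properties using (all?)
open import Data.Product using (_×_; ∃-syntax; _,_; proj₁; proj₂)
open import Data.Sum using (_⊎_; inj₁; inj₂; [_,_]′)
open import Data.Empty using (⊥-elim)
open import Function using (id)
open import Relation.Nullary using (Dec; yes; no)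
open import Relation.Binary.PropositionalEquality using (_≡_; refl; sym; trans; subst)

walk : {P : ℕ → Set} {R : Set} {a b : ℕ} → a ≤′ b → P a →
       (∀ {t} → a ≤ t → t < b → P t → R ⊎ P (suc t)) → (P b → R) → R
walk ≤′-refl pa step done = done pa
walk (≤′-step a≤′b) pa step done =
  walk a≤′b pa (λ a≤t t<b → step a≤t (m≤n⇒m≤1+n t<b))
       (λ pb → [ id , done ]′ (step (≤′⇒≤ a≤′b) ≤-refl pb))

_⪯?_ : (x y : Point) → Dec (x ⪯ y)
x ⪯? y = all? (λ k → x k ≤? y k)

⪯-refl : {x : Point} → x ⪯ x
⪯-refl _ = ≤-refl

violation-or-monotone : (f : Point → Point) {x y : Point} → x ⪯ y →
                        Violation f x y ⊎ (f x ⪯ f y)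
violation-or-monotone f {x} {y} x⪯y with f x ⪯? f y
... | yes fx⪯fy = inj₂ fx⪯fy
... | no fx⋠fy = inj₁ (x⪯y , fx⋠fy)

InSlice-between : {n : Point} {s₃ : ℕ} {d x b : Point} →
                  InSlice n s₃ d → InSlice n s₃ b → d ⪯ x → x ⪯ b → InSlice n s₃ x
InSlice-between {x = x} (d∈L , d₃≡s₃) (b∈L , b₃≡s₃) d⪯x x⪯b =
  (λ k → ≤-trans (proj₁ (d∈L k)) (d⪯x k) , ≤-trans (x⪯b k) (proj₂ (b∈L k))) ,
  ≤-antisym (subst (x i₃ ≤_) b₃≡s₃ (x⪯b i₃)) (subst (_≤ x i₃) d₃≡s₃ (d⪯x i₃))

restrict-plane : (k : PlaneIdx) (f : Point → Point) (s₃ : ℕ) (x : Point) →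
                 restrict f s₃ x (toFin k) ≡ f x (toFin k)
restrict-plane one f s₃ x = refl
restrict-plane two f s₃ x = refl

line : PlaneIdx → Point → ℕ → Point
line one d t zero = d zero
line one d t (suc zero) = t
line one d t (suc (suc zero)) = d i₃
line two d t zero = t
line two d t (suc zero) = d (suc zero)
line two d t (suc (suc zero)) = d i₃

line-mono : (i : PlaneIdx) (d : Point) {t t′ : ℕ} → t ≤ t′ → line i d t ⪯ line i d t′
line-mono one d t≤t′ = λ { zero → ≤-refl ; (suc zero) → t≤t′ ; (suc (suc zero)) → ≤-refl }
line-mono two d t≤t′ = λ { zero → t≤t′ ; (suc zero) → ≤-refl ; (suc (suc zero)) → ≤-refl }

⪯-line : (i : PlaneIdx) (d : Point) {x : Point} {t : ℕ} →
         x (toFin i) ≤ d (toFin i) → x (toFin (other i)) ≤ t → x i₃ ≤ d i₃ →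
         x ⪯ line i d t
⪯-line one d p q r = λ { zero → p ; (suc zero) → q ; (suc (suc zero)) → r }
⪯-line two d p q r = λ { zero → q ; (suc zero) → p ; (suc (suc zero)) → r }

line-⪯ : (i : PlaneIdx) (d : Point) {y : Point} {t : ℕ} →
         d (toFin i) ≤ y (toFin i) → t ≤ y (toFin (other i)) → d i₃ ≤ y i₃ →
         line i d t ⪯ y
line-⪯ one d p q r = λ { zero → p ; (suc zero) → q ; (suc (suc zero)) → r }
line-⪯ two d p q r = λ { zero → q ; (suc zero) → p ; (suc (suc zero)) → r }

module _ (n : Point) (f : Point → Point) (s₃ : ℕ) (d b : Point) (i : PlaneIdx)
         (d∈s : InSlice n s₃ d) (b∈s : InSlice n s₃ b)
         (dᵢ≡bᵢ : d (toFin i) ≡ b (toFin i)) where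

  private
    I J : Fin 3
    I = toFin i
    J = toFin (other i)

    c : ℕ → Point
    c = line i d

  Conclusion : Set
  Conclusion = (∃[ c ] (d ⪯ c × c ⪯ b × InUp n f c))
             ⊎ (∃[ x ] ∃[ y ] (d ⪯ x × x ⪯ y × y ⪯ b × Violation f x y))
             ⊎ (∃[ c ] (d ⪯ c × c ⪯ b × InDownSlice n f s₃ c))

  Rising : ℕ → Set
  Rising t = t ≤ f (c t) J × d i₃ ≤ f (c t) i₃

  d⪯line : {t : ℕ} → d J ≤ t → d ⪯ c t
  d⪯line dⱼ≤t = ⪯-line i d ≤-refl dⱼ≤t ≤-refl

  line⪯b : {t : ℕ} → t ≤ b J → c t ⪯ b
  line⪯b t≤bⱼ = line-⪯ i d (≤-reflexive dᵢ≡bᵢ) t≤bⱼ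
                  (≤-reflexive (trans (proj₂ d∈s) (sym (proj₂ b∈s))))

  line∈s : {t : ℕ} → d J ≤ t → t ≤ b J → InSlice n s₃ (c t)
  line∈s dⱼ≤t t≤bⱼ = InSlice-between d∈s b∈s (d⪯line dⱼ≤t) (line⪯b t≤bⱼ)

  up-or-down-or-rising : {t : ℕ} → d J ≤ t → t ≤ b J → Rising t →
                         Conclusion ⊎ t < f (c t) J
  up-or-down-or-rising {t} dⱼ≤t t≤bⱼ (t≤fⱼ , d₃≤f₃)
    with d I ≤? f (c t) I | f (c t) J ≤? t
  ... | yes dᵢ≤fᵢ | _ =
    inj₁ (inj₁ (c t , d⪯line dⱼ≤t , line⪯b t≤bⱼ , proj₁ (line∈s dⱼ≤t t≤bⱼ) ,
                line-⪯ i d dᵢ≤fᵢ t≤fⱼ d₃≤f₃))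
  ... | no dᵢ≰fᵢ | yes fⱼ≤t =
    inj₁ (inj₂ (inj₂ (c t , d⪯line dⱼ≤t , line⪯b t≤bⱼ , line∈s dⱼ≤t t≤bⱼ ,
                      ⪯-line i d restrictᵢ≤dᵢ restrictⱼ≤t (≤-reflexive (sym (proj₂ d∈s))))))
    where restrictᵢ≤dᵢ : restrict f s₃ (c t) I ≤ d I
          restrictᵢ≤dᵢ = subst (_≤ d I) (sym (restrict-plane i f s₃ (c t))) (<⇒≤ (≰⇒> dᵢ≰fᵢ))
          restrictⱼ≤t : restrict f s₃ (c t) J ≤ t
          restrictⱼ≤t = subst (_≤ t) (sym (restrict-plane (other i) f s₃ (c t))) fⱼ≤t
  ... | no _ | no fⱼ≰t = inj₂ (≰⇒> fⱼ≰t)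

  -- d and c (d J) agree pointwise, but f need not respect that, so the two are
  -- compared like any other consecutive points of the walk.
  start : d J ≤ b J → d J ≤ f d J → d i₃ ≤ f d i₃ → Conclusion ⊎ Rising (d J)
  start dⱼ≤bⱼ dⱼ≤fⱼ d₃≤f₃ with violation-or-monotone f (d⪯line ≤-refl)
  ... | inj₁ v = inj₁ (inj₂ (inj₁ (d , c (d J) , ⪯-refl , d⪯line ≤-refl , line⪯b dⱼ≤bⱼ , v)))
  ... | inj₂ fd⪯fc = inj₂ (≤-trans dⱼ≤fⱼ (fd⪯fc J) , ≤-trans d₃≤f₃ (fd⪯fc i₃))

  step : {t : ℕ} → d J ≤ t → t < b J → Rising t → Conclusion ⊎ Rising (suc t)
  step {t} dⱼ≤t t<bⱼ rising with up-or-down-or-rising dⱼ≤t (<⇒≤ t<bⱼ) rising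
  ... | inj₁ r = inj₁ r
  ... | inj₂ t<fⱼ with violation-or-monotone f (line-mono i d (n≤1+n t))
  ...   | inj₁ v = inj₁ (inj₂ (inj₁ (c t , c (suc t) , d⪯line dⱼ≤t , line-mono i d (n≤1+n t) ,
                                     line⪯b t<bⱼ , v)))
  ...   | inj₂ fc⪯fc′ = inj₂ (≤-trans t<fⱼ (fc⪯fc′ J) , ≤-trans (proj₂ rising) (fc⪯fc′ i₃))

  finish : d J ≤ b J → f b J ≤ b J → Rising (b J) → Conclusion
  finish dⱼ≤bⱼ fⱼ≤bⱼ rising with up-or-down-or-rising dⱼ≤bⱼ ≤-refl rising
  ... | inj₁ r = r
  ... | inj₂ bⱼ<fⱼ with violation-or-monotone f (line⪯b ≤-refl)
  ...   | inj₁ v = inj₂ (inj₁ (c (b J) , b , d⪯line dⱼ≤bⱼ , line⪯b ≤-refl , ⪯-refl , v))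
  ...   | inj₂ fc⪯fb = ⊥-elim (<⇒≱ bⱼ<fⱼ (≤-trans (fc⪯fb J) fⱼ≤bⱼ))

  walk-to-b : d J ≤ b J → d J ≤ f d J → f b J ≤ b J → d i₃ ≤ f d i₃ → Conclusion
  walk-to-b dⱼ≤bⱼ dⱼ≤fⱼ fⱼ≤bⱼ d₃≤f₃ with start dⱼ≤bⱼ dⱼ≤fⱼ d₃≤f₃
  ... | inj₁ r = r
  ... | inj₂ rising = walk (≤⇒≤′ dⱼ≤bⱼ) rising step (finish dⱼ≤bⱼ fⱼ≤bⱼ)

lemma7 : (n : Point) (f : Point → Point) →
    (∀ x → InL n x → InL n (f x)) →
    (s₃ : ℕ) → (d b : Point) →
    DownSetWitness n f s₃ d b →
    (∃[ c ] (d ⪯ c × c ⪯ b × InUp n f c))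
    ⊎ (∃[ x ] ∃[ y ] (d ⪯ x × x ⪯ y × y ⪯ b × Violation f x y))
    ⊎ (∃[ c ] (d ⪯ c × c ⪯ b × InDownSlice n f s₃ c))
lemma7 n f _ s₃ d b (d∈s , b∈s , d₃≤f₃ , _ , i , dᵢ≡bᵢ , dⱼ≤bⱼ , dⱼ≤fⱼ , fⱼ≤bⱼ) =
  walk-to-b n f s₃ d b i d∈s b∈s dᵢ≡bᵢ dⱼ≤bⱼ dⱼ≤fⱼ fⱼ≤bⱼ d₃≤f₃
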